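{- Fix integers $D\ge2$ and $N\ge1$ in KSPM($D$). Let $L=L(D,N)$ be the global density column and $\Phi=(\phi^1,\dots,\phi^n)$ the sequence of long avalanches up to $N$. Let $k<n$. Let $P^k$ (resp. $P^{k+1}$) be the set of peaks $i$ of $\phi^k$ (resp. $\phi^{k+1}$) such that $i\ge L+2(D-1)$. Assume $P^k$ is nonempty, and let $\max P^k$ denote its largest element. Then $$P^k\setminus\{\max P^k\}=P^{k+1}\cap\{j\in\mathbb Z: L+2(D-1)\le j<\max P^k\}.$$
   Context: KSPM($D$), for an integer $D\ge2$: - A configuration is an ultimately null sequence $\sigma=(\sigma_0,\sigma_1,\dots)$ of nonnegative integers (height differences between consecutive columns). - A transition on column $i$, $\sigma\xrightarrow{i}\sigma'$, is allowed when $\sigma_i\ge D$. It gives $\sigma'_{i-1}=\sigma_{i-1}+D-1$ (if $i\neq0$), $\sigma'_i=\sigma_i-D$, $\sigma'_{i+D-1}=\sigma_{i+D-1}+1$, and leaves all other entries unchanged. Firing column $i$ means performing this transition. - A configuration is stable if no transition applies. Each configuration $\sigma$ reaches a unique stable configuration $\pi(\sigma)$. - Write $\pi(N)=\pi((N,0,0,\dots))$, and $\sigma^{\downarrow0}=(\sigma_0+1,\sigma_1,\sigma_2,\dots)$. Then $\pi(\pi(k-1)^{\downarrow0})=\pi(k)$. Avalanches: - A strategy is a finite sequence $s=(s_1,\dots,s_T)$ of columns. Applying it means firing $s_1$, then $s_2$, and so on. - The $k$-th avalanche $s^k$ is the lexicographically minimal strategy leading from $\pi(k-1)^{\downarrow0}$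 to $\pi(k)$. Equivalently, at each step the leftmost possible column is fired. - Write $j\in s$ if $j=s_t$ for some $t$. - A column $s_t$ is a peak of $s$ if $s_t>\max\{s_1,\dots,s_{t-1}\}$ (so $s_1$ is a peak). - An avalanche $s$ is dense starting at $l$ if, with $m$ the greatest fired column, every column $j$ with $l\le j\le m$ belongs to $s$. - The global density column $L(D,N)$ is the minimal $l$ such that every avalanche $s^k$ with $k\le N$ is dense starting at $l$. - The sequence of long avalanches up to $N$, $\Phi=(\phi^1,\dots,\phi^n)$, is the subsequence, in order, of $(s^1,\dots,s^N)$ consisting of those $s^k$ with $L(D,N)+D-1\in s^k$. -}

module Defs where

open import Data.Nat using (ℕ; zero; suc; _+_; _*_; _∸_; _≤_; _<_; _≥_; _≟_)
open import Data.Bool using (Bool; true; false; if_then_else_)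
open import Data.List using (List; []; _∷_; _++_; _∷ʳ_; filter)
open import Data.List.Relation.Unary.All using (All)
open import Data.List.Membership.Propositional using (_∈_)
open import Data.List.Membership.DecPropositional _≟_ using (_∈?_)
open import Data.Product using (Σ; ∃; _×_; _,_)
open import Relation.Nullary using (¬_)
open import Relation.Nullary.Decidable using (⌊_⌋)
open import Relation.Binary.PropositionalEquality using (_≡_)

-- A configuration: column i ↦ height difference σ_i.  All configurations
-- that arise below are reached from the zero configuration, hence ultimately null.
Config : Set
Config = ℕ → ℕ

zeroConfig : Config
zeroConfig _ = 0

addGrain : Config → Config
addGrain σ zero    = suc (σ zero)
addGrain σ (suc j) = σ (suc j)

cond : Bool → ℕ → ℕ
cond b n = if b then n else 0

-- firing column i in KSPM(D) (applied only when σ i ≥ D):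
--   σ'_{i-1} = σ_{i-1} + D - 1 (if i ≠ 0), σ'_i = σ_i - D, σ'_{i+D-1} = σ_{i+D-1} + 1
fire : ℕ → ℕ → Config → Config
fire D i σ j =
  (σ j ∸ cond ⌊ j ≟ i ⌋ D)
  + cond ⌊ suc j ≟ i ⌋ (D ∸ 1)
  + cond ⌊ j ≟ i + (D ∸ 1) ⌋ 1

Stable : ℕ → Config → Set
Stable D σ = ∀ i → σ i < D

Leftmost : ℕ → Config → ℕ → Set
Leftmost D σ i = (D ≤ σ i) × (∀ j → j < i → σ j < D)

-- LMRun D σ s τ : firing at each step the leftmost possible column, the
-- strategy s leads from σ to the stable configuration τ
-- (this is the lexicographically minimal strategy from σ to π(σ)).
data LMRun (D : ℕ) : Config → List ℕ → Config → Set where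
  done : ∀ {σ} → Stable D σ → LMRun D σ [] σ
  step : ∀ {σ i s τ} → Leftmost D σ i → LMRun D (fire D i σ) s τ →
         LMRun D σ (i ∷ s) τ

-- Avalanches D k ss σ : ss = (s^1, …, s^k) are the first k avalanches and σ = π(k)
data Avalanches (D : ℕ) : ℕ → List (List ℕ) → Config → Set where
  base : Avalanches D 0 [] zeroConfig
  next : ∀ {k ss σ s τ} → Avalanches D k ss σ → LMRun D (addGrain σ) s τ →
         Avalanches D (suc k) (ss ∷ʳ s) τ

IsMaxOf : List ℕ → ℕ → Set
IsMaxOf s m = (m ∈ s) × (∀ x → x ∈ s → x ≤ m)

DenseFrom : ℕ → List ℕ → Set
DenseFrom l s = ∀ m → IsMaxOf s m → ∀ j → l ≤ j → j ≤ m → j ∈ s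

IsGlobalDensity : List (List ℕ) → ℕ → Set
IsGlobalDensity ss L =
  All (DenseFrom L) ss × (∀ l → All (DenseFrom l) ss → L ≤ l)

longAvalanches : ℕ → ℕ → List (List ℕ) → List (List ℕ)
longAvalanches D L ss = filter (λ s → (L + (D ∸ 1)) ∈? s) ss

IsPeak : List ℕ → ℕ → Set
IsPeak s i = Σ (List ℕ) λ xs → Σ (List ℕ) λ ys → (s ≡ xs ++ i ∷ ys) × All (_< i) xs

InP : ℕ → ℕ → List ℕ → ℕ → Set
InP D L s i = IsPeak s i × (L + 2 * (D ∸ 1) ≤ i)

module Submission where

-- Write d = D - 1.  An avalanche starts from τ, a stable configuration with
-- one grain added on column 0, and fires the leftmost unstable column at each
-- step.  Everything rests on conservation of grains along such a run: column
-- j ends with its initial grains, minus D per firing of j, plus d per firing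
-- of j + 1 and one per firing of j - d.  It follows that every column fires
-- at most once and then holds at most d grains, and that every peak p ≥ 1
-- starts with exactly d grains and lies within d of the preceding peak.  For
-- an avalanche dense from L, the peaks j ≥ L + 2d are then exactly the columns
-- with τ j = d (up to the maximal column): a full column strictly between two
-- consecutive peaks would be fed, hence unstable, before the later one fires.
--
-- Between two consecutive long avalanches φ and φ′ only short avalanches
-- occur.  The dense avalanche φ restores every column in [L + d, M), M its
-- maximal column, and the short ones add grains only left of L + 2d, so the
-- starting configurations of φ and φ′ agree on [L + 2d, M) and the two
-- avalanches have the same peaks there; a peak of φ beyond the maximal column
-- of φ′ would leave the end of φ′ unstable.  Since max P^k is the maximal
-- column of φ^k, this is the theorem.

open import Defs
open import Data.Nat using (ℕ; zero; suc; _+_; _∸_; _*_; _≤_; _<_; _≥_; z≤n; s≤s; _≟_; _≤?_; _<?_)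
open import Data.Nat.Properties
open import Data.List using (List; []; _∷_; _++_; _∷ʳ_; filter)
open import Data.List.Properties using (++-assoc; ++-identityʳ; ∷-injective; filter-accept; filter-reject)
open import Data.List.Relation.Unary.All as All using (All; []; _∷_)
open import Data.List.Relation.Unary.All.Properties using (++⁺; ++⁻ˡ; ++⁻ʳ; ¬All⇒Any¬)
open import Data.List.Relation.Unary.Any using (here; there)
open import Data.List.Membership.Propositional using (_∈_; find)
open import Data.List.Membership.Propositional.Properties using (∈-++⁺ˡ; ∈-++⁺ʳ; ∈-++⁻)
open import Data.List.Membership.DecPropositional _≟_ using (_∈?_)
open import Data.Product using (∃-syntax; _×_; _,_; proj₁; proj₂)
open import Data.Sum using (_⊎_; inj₁; inj₂)
open import Data.Empty using (⊥-elim)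
open import Function.Base using (_∘_)
open import Function.Bundles using (_⇔_; mk⇔)
open import Relation.Nullary using (¬_; yes; no; Dec)
open import Relation.Nullary.Decidable using (⌊_⌋)
open import Relation.Binary.Definitions using (tri<; tri≈; tri>)
open import Relation.Binary.PropositionalEquality
  using (_≡_; _≢_; refl; sym; trans; cong; cong₂; subst; module ≡-Reasoning)
open import Data.Nat.Induction using (<-wellFounded)
open import Induction.WellFounded using (Acc; acc)
open import Data.Nat.Tactic.RingSolver using (solve-∀)

module KSPM (e : ℕ) where

  d : ℕ
  d = suc e

  D : ℕ
  D = suc d

  δ : ℕ → ℕ → ℕ
  δ a b = cond ⌊ a ≟ b ⌋ 1

  δ-refl : ∀ a → δ a a ≡ 1
  δ-refl a with a ≟ a
  ... | yes _ = refl
  ... | no a≢a = ⊥-elim (a≢a refl)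

  δ-≢ : ∀ {a b} → a ≢ b → δ a b ≡ 0
  δ-≢ {a} {b} a≢b with a ≟ b
  ... | yes a≡b = ⊥-elim (a≢b a≡b)
  ... | no _ = refl

  fires : ℕ → List ℕ → ℕ
  fires j [] = 0
  fires j (x ∷ s) = δ j x + fires j s

  feeds : ℕ → List ℕ → ℕ
  feeds j [] = 0
  feeds j (x ∷ s) = δ j (x + d) + feeds j s

  fires-pos : ∀ {j s} → j ∈ s → 1 ≤ fires j s
  fires-pos {j} (here refl) rewrite δ-refl j = s≤s z≤n
  fires-pos {j} {x ∷ s} (there j∈s) = ≤-trans (fires-pos j∈s) (m≤n+m (fires j s) (δ j x))

  fires-absent : ∀ {j s} → ¬ j ∈ s → fires j s ≡ 0
  fires-absent {s = []} _ = refl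
  fires-absent {j} {x ∷ s} j∉x∷s rewrite δ-≢ (λ j≡x → j∉x∷s (here j≡x)) =
    fires-absent (λ j∈s → j∉x∷s (there j∈s))

  fires-++ : ∀ j xs ys → fires j (xs ++ ys) ≡ fires j xs + fires j ys
  fires-++ j [] ys = refl
  fires-++ j (x ∷ xs) ys =
    trans (cong (δ j x +_) (fires-++ j xs ys)) (sym (+-assoc (δ j x) (fires j xs) (fires j ys)))

  fires-below : ∀ {j s} → All (_< j) s → fires j s ≡ 0
  fires-below s<j = fires-absent (λ j∈s → <-irrefl refl (All.lookup s<j j∈s))

  feeds-pos : ∀ {x j s} → x ∈ s → x + d ≡ j → 1 ≤ feeds j s
  feeds-pos {x} (here refl) refl rewrite δ-refl (x + d) = s≤s z≤n
  feeds-pos {j = j} {y ∷ s} (there x∈s) x+d≡j =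
    ≤-trans (feeds-pos x∈s x+d≡j) (m≤n+m (feeds j s) (δ j (y + d)))

  feeds-witness : ∀ {j} s → 1 ≤ feeds j s → ∃[ x ] x ∈ s × x + d ≡ j
  feeds-witness {j} (x ∷ s) pos with j ≟ x + d
  ... | yes j≡x+d = x , here refl , sym j≡x+d
  ... | no _ with feeds-witness s pos
  ...   | y , y∈s , y+d≡j = y , there y∈s , y+d≡j

  feeds-absent : ∀ {j s} → All (λ x → j ≢ x + d) s → feeds j s ≡ 0
  feeds-absent [] = refl
  feeds-absent (j≢x+d ∷ rest) rewrite δ-≢ j≢x+d = feeds-absent rest

  feeds≤fires : ∀ j s → feeds j s ≤ fires (j ∸ d) s
  feeds≤fires j [] = z≤n
  feeds≤fires j (x ∷ s) = +-mono-≤ (one j x) (feeds≤fires j s)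
    where
    one : ∀ j x → δ j (x + d) ≤ δ (j ∸ d) x
    one j x with j ≟ x + d
    ... | no _ = z≤n
    ... | yes refl rewrite m+n∸n≡m x d | δ-refl x = ≤-refl

  feeds-zero : ∀ s → feeds 0 s ≡ 0
  feeds-zero s = feeds-absent (All.tabulate {xs = s} (λ {x} _ 0≡x+d → 0≢1+n (trans 0≡x+d (+-suc x e))))

  fire-balance : ∀ i (ρ : Config) j → D ≤ ρ i →
    fire D i ρ j + D * δ j i ≡ ρ j + d * δ (suc j) i + δ j (i + d)
  fire-balance i ρ j D≤ρi with j ≟ i | suc j ≟ i | j ≟ i + d
  ... | yes refl | yes 1+j≡j | _ = ⊥-elim (1+n≢n 1+j≡j)
  ... | yes refl | no _ | yes j≡j+d = ⊥-elim (m+1+n≢m j (sym j≡j+d))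
  ... | no _ | yes refl | yes j≡1+j+d = ⊥-elim (m≢1+m+n j j≡1+j+d)
  ... | yes refl | no _ | no _ =
    trans (lose (ρ j ∸ D) e) (trans (m∸n+n≡m D≤ρi) (keep (ρ j) e))
    where
    lose : ∀ a e → a + 0 + 0 + suc (suc e) * 1 ≡ a + suc (suc e)
    lose = solve-∀
    keep : ∀ a e → a ≡ a + suc e * 0 + 0
    keep = solve-∀
  ... | no _ | yes refl | no _ = gain (ρ j) e
    where
    gain : ∀ a e → a + suc e + 0 + suc (suc e) * 0 ≡ a + suc e * 1 + 0
    gain = solve-∀
  ... | no _ | no _ | yes _ = gain (ρ j) e
    where
    gain : ∀ a e → a + 0 + 1 + suc (suc e) * 0 ≡ a + suc e * 0 + 1
    gain = solve-∀
  ... | no _ | no _ | no _ = same (ρ j) e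
    where
    same : ∀ a e → a + 0 + 0 + suc (suc e) * 0 ≡ a + suc e * 0 + 0
    same = solve-∀

  fire-far : ∀ i (ρ : Config) j → suc j < i → fire D i ρ j ≡ ρ j
  fire-far i ρ j 1+j<i with j ≟ i | suc j ≟ i | j ≟ i + d
  ... | yes refl | _ | _ = ⊥-elim (<-irrefl refl (<-trans (n<1+n j) 1+j<i))
  ... | no _ | yes refl | _ = ⊥-elim (<-irrefl refl 1+j<i)
  ... | no _ | no _ | yes refl = ⊥-elim (<-irrefl refl (<-trans (n<1+n (i + d)) (≤-trans 1+j<i (m≤m+n i d))))
  ... | no _ | no _ | no _ = trans (+-identityʳ _) (+-identityʳ _)

  data Run : Config → List ℕ → Config → Set where
    stop : ∀ {σ} → Run σ [] σ
    _▸_  : ∀ {σ i s τ} → Leftmost D σ i → Run (fire D i σ) s τ → Run σ (i ∷ s) τ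

  infixr 5 _▸_

  avalanche-run : ∀ {σ s τ} → LMRun D σ s τ → Run σ s τ × Stable D τ
  avalanche-run (done τ-stable) = stop , τ-stable
  avalanche-run (step leftmost rest) with avalanche-run rest
  ... | r , τ-stable = leftmost ▸ r , τ-stable

  run-split : ∀ xs {ys σ τ} → Run σ (xs ++ ys) τ → ∃[ ρ ] Run σ xs ρ × Run ρ ys τ
  run-split [] r = _ , stop , r
  run-split (x ∷ xs) (leftmost ▸ r) with run-split xs r
  ... | ρ , r₁ , r₂ = ρ , leftmost ▸ r₁ , r₂

  run-snoc : ∀ {σ xs ρ i} → Run σ xs ρ → Leftmost D ρ i → Run σ (xs ∷ʳ i) (fire D i ρ)
  run-snoc stop leftmost = leftmost ▸ stop
  run-snoc (leftmost′ ▸ r) leftmost = leftmost′ ▸ run-snoc r leftmost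

  conservation : ∀ {τ s ρ} → Run τ s ρ → ∀ j →
    ρ j + D * fires j s ≡ τ j + d * fires (suc j) s + feeds j s
  conservation {τ} stop j = no-firing (τ j) e
    where
    no-firing : ∀ a e → a + suc (suc e) * 0 ≡ a + suc e * 0 + 0
    no-firing = solve-∀
  conservation {τ} {i ∷ s} {ρ} ((D≤τi , _) ▸ r) j = begin
    ρ j + D * (δ j i + fires j s)
      ≡⟨ shift (ρ j) (δ j i) (fires j s) e ⟩
    (ρ j + D * fires j s) + D * δ j i
      ≡⟨ cong (_+ D * δ j i) (conservation r j) ⟩
    (fire D i τ j + d * fires (suc j) s + feeds j s) + D * δ j i
      ≡⟨ reorder (fire D i τ j) (d * fires (suc j) s) (feeds j s) (δ j i) e ⟩
    (fire D i τ j + D * δ j i) + d * fires (suc j) s + feeds j s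
      ≡⟨ cong (λ x → x + d * fires (suc j) s + feeds j s) (fire-balance i τ j D≤τi) ⟩
    (τ j + d * δ (suc j) i + δ j (i + d)) + d * fires (suc j) s + feeds j s
      ≡⟨ collect (τ j) (δ (suc j) i) (δ j (i + d)) (fires (suc j) s) (feeds j s) e ⟩
    τ j + d * (δ (suc j) i + fires (suc j) s) + (δ j (i + d) + feeds j s) ∎
    where
    open ≡-Reasoning
    shift : ∀ a x y e → a + suc (suc e) * (x + y) ≡ (a + suc (suc e) * y) + suc (suc e) * x
    shift = solve-∀
    reorder : ∀ a b c x e → a + b + c + suc (suc e) * x ≡ (a + suc (suc e) * x) + b + c
    reorder = solve-∀
    collect : ∀ a x y u v e →
      a + suc e * x + y + suc e * u + v ≡ a + suc e * (x + u) + (y + v)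
    collect = solve-∀

  -- While every firing is left of column j, neither j nor j + 1 fires, so j
  -- holds its initial grains plus the grains it was fed.
  unfired-balance : ∀ {τ s ρ j} → Run τ s ρ → All (_< j) s → ρ j ≡ τ j + feeds j s
  unfired-balance {τ} {s} {ρ} {j} r s<j = begin
    ρ j                                     ≡⟨ sym (+-identityʳ (ρ j)) ⟩
    ρ j + 0                                 ≡⟨ cong (ρ j +_) (sym (*-zeroʳ D)) ⟩
    ρ j + D * 0                             ≡⟨ cong (λ n → ρ j + D * n) (sym (fires-below s<j)) ⟩
    ρ j + D * fires j s                     ≡⟨ conservation r j ⟩
    τ j + d * fires (suc j) s + feeds j s   ≡⟨ cong (λ n → τ j + d * n + feeds j s) j+1-unfired ⟩
    τ j + d * 0 + feeds j s                 ≡⟨ cong (λ n → τ j + n + feeds j s) (*-zeroʳ d) ⟩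
    τ j + 0 + feeds j s                     ≡⟨ cong (_+ feeds j s) (+-identityʳ (τ j)) ⟩
    τ j + feeds j s                         ∎
    where
    open ≡-Reasoning
    j+1-unfired : fires (suc j) s ≡ 0
    j+1-unfired = fires-below (All.map m<n⇒m<1+n s<j)

  -- The bounds satisfied by the configurations from which avalanches start
  -- (a stable configuration with one grain added on column 0).
  Start : Config → Set
  Start τ = (τ 0 ≤ D) × (∀ j → τ (suc j) ≤ d)

  start-of-stable : ∀ {σ} → Stable D σ → Start (addGrain σ)
  start-of-stable σ-stable = σ-stable 0 , λ j → ≤-pred (σ-stable (suc j))

  addGrain-right : ∀ σ {i} → 1 ≤ i → addGrain σ i ≡ σ i
  addGrain-right σ {suc i} _ = refl

  start-right : ∀ {τ j} → Start τ → 1 ≤ j → τ j ≤ d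
  start-right {j = suc j} (_ , τ≤d) _ = τ≤d j

  start-feeds : ∀ {τ s} → Start τ → (∀ j → fires j s ≤ 1) → ∀ j → τ j + feeds j s ≤ D
  start-feeds {τ} {s} (τ0≤D , _) _ zero rewrite feeds-zero s | +-identityʳ (τ 0) = τ0≤D
  start-feeds {τ} {s} (_ , τ≤d) once (suc j) =
    subst (τ (suc j) + feeds (suc j) s ≤_) (+-comm d 1)
      (+-mono-≤ (τ≤d j) (≤-trans (feeds≤fires (suc j) s) (once (suc j ∸ d))))

  Settled : List ℕ → Config → Set
  Settled s ρ = (∀ j → fires j s ≤ 1) × (∀ j → j ∈ s → ρ j ≤ d)

  -- One more leftmost firing preserves settledness: the fired column cannot
  -- have fired before (it would hold at most d grains), and conservation
  -- bounds every fired column afterwards.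
  settled-step : ∀ {τ xs ρ i} → Start τ → Run τ xs ρ → Settled xs ρ → Leftmost D ρ i →
    Settled (xs ∷ʳ i) (fire D i ρ)
  settled-step {τ} {xs} {ρ} {i} τ-start r (once , low) leftmost@(D≤ρi , _) = once′ , low′
    where
    i∉xs : ¬ i ∈ xs
    i∉xs i∈xs = <-irrefl refl (≤-trans D≤ρi (low i i∈xs))
    once′ : ∀ j → fires j (xs ∷ʳ i) ≤ 1
    once′ j rewrite fires-++ j xs (i ∷ []) with j ≟ i
    ... | yes refl rewrite fires-absent i∉xs = ≤-refl
    ... | no _ rewrite +-identityʳ (fires j xs) = once j
    ρ′ : Config
    ρ′ = fire D i ρ
    s′ : List ℕ
    s′ = xs ∷ʳ i
    low′ : ∀ j → j ∈ s′ → ρ′ j ≤ d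
    low′ j j∈s′ = +-cancelʳ-≤ D (ρ′ j) d (begin
      ρ′ j + D                             ≡⟨ cong (ρ′ j +_) (*-identityʳ D) ⟨
      ρ′ j + D * 1                         ≤⟨ +-monoʳ-≤ (ρ′ j) (*-monoʳ-≤ D (fires-pos j∈s′)) ⟩
      ρ′ j + D * fires j s′                ≡⟨ conservation (run-snoc r leftmost) j ⟩
      τ j + d * fires (suc j) s′ + feeds j s′
                                           ≡⟨ regroup (τ j) (fires (suc j) s′) (feeds j s′) e ⟩
      d * fires (suc j) s′ + (τ j + feeds j s′)
                                           ≤⟨ +-mono-≤ (*-monoʳ-≤ d (once′ (suc j)))
                                                       (start-feeds {τ} {s′} τ-start once′ j) ⟩
      d * 1 + D                            ≡⟨ cong (_+ D) (*-identityʳ d) ⟩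
      d + D                                ∎)
      where
      open ≤-Reasoning
      regroup : ∀ a x y e → a + suc e * x + y ≡ suc e * x + (a + y)
      regroup = solve-∀

  settled : ∀ {τ s ρ} → Start τ → Run τ s ρ → Settled s ρ
  settled {τ} τ-start = extend [] stop ((λ _ → z≤n) , λ _ ())
    where
    extend : ∀ h {σ s ρ} → Run τ h σ → Settled h σ → Run σ s ρ → Settled (h ++ s) ρ
    extend h _ h-settled stop = subst (λ l → Settled l _) (sym (++-identityʳ h)) h-settled
    extend h {s = i ∷ s} r h-settled (leftmost ▸ rest) =
      subst (λ l → Settled l _) (++-assoc h (i ∷ []) s)
        (extend (h ∷ʳ i) (run-snoc r leftmost) (settled-step τ-start r h-settled leftmost) rest)

  bounded-by-first-max : ∀ {q as bs} → All (_< q) as → All (_≤ q) bs → All (_≤ q) (as ++ q ∷ bs)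
  bounded-by-first-max as<q bs≤q = ++⁺ (All.map <⇒≤ as<q) (≤-refl ∷ bs≤q)

  first-maximum : ∀ {x} xs → x ∈ xs → ∃[ as ] ∃[ q ] ∃[ bs ]
    (xs ≡ as ++ q ∷ bs) × All (_< q) as × All (_≤ q) bs
  first-maximum (y ∷ []) _ = [] , y , [] , refl , [] , []
  first-maximum (y ∷ z ∷ zs) _ with first-maximum (z ∷ zs) (here refl)
  ... | as , q , bs , z∷zs≡ , as<q , bs≤q with q ≤? y
  ...   | yes q≤y = [] , y , z ∷ zs , refl , [] ,
            subst (All (_≤ y)) (sym z∷zs≡)
              (All.map (λ w≤q → ≤-trans w≤q q≤y) (bounded-by-first-max as<q bs≤q))
  ...   | no q≰y = y ∷ as , q , bs , cong (y ∷_) z∷zs≡ , ≰⇒> q≰y ∷ as<q , bs≤q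

  peak-∈ : ∀ {s p} → IsPeak s p → p ∈ s
  peak-∈ (xs , ys , refl , _) = ∈-++⁺ʳ xs (here refl)

  maximum-peak : ∀ {s x} → x ∈ s → ∃[ M ] IsMaxOf s M × IsPeak s M
  maximum-peak {s} x∈s with first-maximum s x∈s
  ... | as , M , bs , s≡ , as<M , bs≤M =
    M , (peak-∈ peak , λ z z∈s → All.lookup s≤M z∈s) , peak
    where
    peak : IsPeak s M
    peak = as , bs , s≡ , as<M
    s≤M : All (_≤ M) s
    s≤M = subst (All (_≤ M)) (sym s≡) (bounded-by-first-max as<M bs≤M)

  record NextPeak (s : List ℕ) (q p : ℕ) : Set where
    field
      before between after : List ℕ
      shape     : s ≡ before ++ q ∷ between ++ p ∷ after
      before<q  : All (_< q) before
      between≤q : All (_≤ q) between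
      q<p       : q < p

    prefix : List ℕ
    prefix = before ++ q ∷ between

    shape-at-p : s ≡ prefix ++ p ∷ after
    shape-at-p = trans shape (sym (++-assoc before (q ∷ between) (p ∷ after)))

    prefix≤q : All (_≤ q) prefix
    prefix≤q = bounded-by-first-max before<q between≤q

    q∈prefix : q ∈ prefix
    q∈prefix = ∈-++⁺ʳ before (here refl)

    q∈s : q ∈ s
    q∈s = subst (q ∈_) (sym shape-at-p) (∈-++⁺ˡ q∈prefix)

    q-peak : IsPeak s q
    q-peak = before , between ++ p ∷ after , shape , before<q

    prefix<p : All (_< p) prefix
    prefix<p = All.map (λ z≤q → ≤-<-trans z≤q q<p) prefix≤q

    p-peak : IsPeak s p
    p-peak = prefix , after , shape-at-p , prefix<p

  full-column : ∀ t f → D ≤ t + f → t ≤ d → f ≤ 1 → t ≡ d × f ≡ 1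
  full-column t zero D≤t+0 t≤d _ rewrite +-identityʳ t = ⊥-elim (<-irrefl refl (≤-trans D≤t+0 t≤d))
  full-column t (suc zero) D≤t+1 t≤d _ = ≤-antisym t≤d (≤-pred (subst (D ≤_) (+-comm t 1) D≤t+1)) , refl
  full-column t (suc (suc f)) _ _ (s≤s ())

  first-firing-full : ∀ {τ xs p ys ρ} → Start τ → Run τ (xs ++ p ∷ ys) ρ → All (_< p) xs → 1 ≤ p →
    τ p ≡ d × ∃[ x ] x ∈ xs × x + d ≡ p
  first-firing-full {τ} {xs} {suc p′} τ-start r xs<p _ with run-split xs r
  ... | ρ₀ , r₀ , (D≤ρ₀p , _) ▸ _ =
    let τp≡d , fed-once = full-column (τ p) (feeds p xs) D≤τp+fed (proj₂ τ-start p′) fed-at-most-once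
    in τp≡d , feeds-witness xs (subst (1 ≤_) (sym fed-once) ≤-refl)
    where
    p : ℕ
    p = suc p′
    D≤τp+fed : D ≤ τ p + feeds p xs
    D≤τp+fed = subst (D ≤_) (unfired-balance r₀ xs<p) D≤ρ₀p
    fed-at-most-once : feeds p xs ≤ 1
    fed-at-most-once = ≤-trans (feeds≤fires p xs) (proj₁ (settled τ-start r₀) (p ∸ d))

  peak-full : ∀ {τ s ρ p} → Start τ → Run τ s ρ → IsPeak s p → 1 ≤ p → τ p ≡ d
  peak-full τ-start r (xs , ys , refl , xs<p) 1≤p = proj₁ (first-firing-full τ-start r xs<p 1≤p)

  -- Once a column q has fired and a column p > q fires later, no column ≤ q
  -- fires again: q itself is settled, and the columns left of q were stable
  -- when p fired and are not touched by firings right of q.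
  firings-stay-right : ∀ {τ xs p ys ρ q} → Start τ → Run τ (xs ++ p ∷ ys) ρ →
    q ∈ xs → q < p → All (q <_) ys
  firings-stay-right {τ} {xs} {q = q} τ-start r q∈xs q<p with run-split xs r
  ... | ρ₀ , r₀ , leftmost@(_ , left-of-p-stable) ▸ rest =
    All.tail (walk r₀ q∈xs (λ y y<q → left-of-p-stable y (<-trans y<q q<p)) (leftmost ▸ rest))
    where
    walk : ∀ {A σ ws ρ} → Run τ A σ → q ∈ A → (∀ y → y < q → σ y < D) → Run σ ws ρ → All (q <_) ws
    walk _ _ _ stop = []
    walk {σ = σ} rA q∈A left-stable (_▸_ {i = y} leftmost@(D≤σy , _) rest) =
      q<y ∷ walk (run-snoc rA leftmost) (∈-++⁺ˡ q∈A) left-stable′ rest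
      where
      q<y : q < y
      q<y with <-cmp q y
      ... | tri< q<y _ _ = q<y
      ... | tri≈ _ refl _ = ⊥-elim (<-irrefl refl (≤-trans D≤σy (proj₂ (settled τ-start rA) q q∈A)))
      ... | tri> _ _ y<q = ⊥-elim (<-irrefl refl (≤-trans D≤σy (≤-pred (left-stable y y<q))))
      left-stable′ : ∀ z → z < q → fire D y σ z < D
      left-stable′ z z<q = subst (_< D) (sym (fire-far y σ z (<-≤-trans (s≤s z<q) q<y))) (left-stable z z<q)

  previous-peak : ∀ {τ s ρ p} → Start τ → Run τ s ρ → IsPeak s p → 1 ≤ p → ∃[ q ] NextPeak s q p
  previous-peak {p = p} τ-start r (xs , ys , refl , xs<p) 1≤p
    with first-firing-full τ-start r xs<p 1≤p
  ... | _ , _ , x∈xs , _ with first-maximum xs x∈xs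
  ...   | as , q , bs , xs≡ , as<q , bs≤q =
    q , record
      { before = as ; between = bs ; after = ys
      ; shape = trans (cong (_++ p ∷ ys) xs≡) (++-assoc as (q ∷ bs) (p ∷ ys))
      ; before<q = as<q ; between≤q = bs≤q
      ; q<p = All.lookup xs<p (subst (q ∈_) (sym xs≡) (∈-++⁺ʳ as (here refl)))
      }

  next-peak-near : ∀ {τ s ρ q p} → Start τ → Run τ s ρ → NextPeak s q p → τ p ≡ d × p ≤ q + d
  next-peak-near {τ} {ρ = ρ} {q} τ-start r np =
    let τp≡d , x , x∈prefix , x+d≡p =
          first-firing-full τ-start (subst (λ l → Run τ l ρ) shape-at-p r) prefix<p (≤-<-trans z≤n q<p)
    in τp≡d , subst (_≤ q + d) x+d≡p (+-monoˡ-≤ d (All.lookup prefix≤q x∈prefix))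
    where open NextPeak np

  straddling-peaks : ∀ {τ s ρ p i} → Start τ → Run τ s ρ → IsPeak s p → 1 ≤ i → i ≤ p →
    ∃[ q ] ∃[ p′ ] NextPeak s q p′ × q < i × i ≤ p′ × p′ ≤ p
  straddling-peaks {s = s} {p = p} {i} τ-start r = descend p (<-wellFounded p)
    where
    descend : ∀ p → Acc _<_ p → IsPeak s p → 1 ≤ i → i ≤ p →
      ∃[ q ] ∃[ p′ ] NextPeak s q p′ × q < i × i ≤ p′ × p′ ≤ p
    descend p (acc smaller) p-peak 1≤i i≤p with previous-peak τ-start r p-peak (≤-trans 1≤i i≤p)
    ... | q , np with q <? i
    ...   | yes q<i = q , p , np , q<i , i≤p , ≤-refl
    ...   | no q≮i with descend q (smaller (NextPeak.q<p np)) (NextPeak.q-peak np) 1≤i (≮⇒≥ q≮i)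
    ...     | q′ , p′ , np′ , q′<i , i≤p′ , p′≤q =
      q′ , p′ , np′ , q′<i , i≤p′ , ≤-trans p′≤q (<⇒≤ (NextPeak.q<p np))

  dense-feeder : ∀ {L s M j} → DenseFrom L s → M ∈ s → L + d ≤ j → j ≤ M + d → j ∸ d ∈ s
  dense-feeder {L} {M = M} {j} dense M∈s L+d≤j j≤M+d with maximum-peak M∈s
  ... | top , (top∈s , s≤top) , _ =
    dense top (top∈s , s≤top) (j ∸ d) (m+n≤o⇒m≤o∸n L L+d≤j)
      (≤-trans (m≤n+o⇒m∸n≤o j d (subst (j ≤_) (+-comm M d) j≤M+d)) (s≤top M M∈s))

  -- The columns ≤ q that are fired at all are fired before the peak p
  -- following q, since after p only columns right of q fire.
  fired-before-next-peak : ∀ {τ s ρ q p w} → Start τ → Run τ s ρ → (np : NextPeak s q p) →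
    w ∈ s → w ≤ q → w ∈ NextPeak.prefix np
  fired-before-next-peak {τ} {ρ = ρ} {q} {p} {w} τ-start r np w∈s w≤q =
    locate (∈-++⁻ prefix (subst (w ∈_) shape-at-p w∈s))
    where
    open NextPeak np
    after>q : All (q <_) after
    after>q = firings-stay-right τ-start (subst (λ l → Run τ l ρ) shape-at-p r) q∈prefix q<p
    locate : w ∈ prefix ⊎ w ∈ p ∷ after → w ∈ prefix
    locate (inj₁ w∈prefix) = w∈prefix
    locate (inj₂ (here w≡p)) = ⊥-elim (<⇒≢ (≤-<-trans w≤q q<p) w≡p)
    locate (inj₂ (there w∈after)) = ⊥-elim (<-irrefl refl (<-≤-trans (All.lookup after>q w∈after) w≤q))

  fed-below-D : ∀ t f → 1 ≤ f → t + f < D → t < d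
  fed-below-D t f 1≤f t+f<D =
    ≤-pred (≤-trans (s≤s (subst (_≤ t + f) (+-comm t 1) (+-monoʳ-≤ t 1≤f))) t+f<D)

  -- The columns strictly between two consecutive peaks q < p of a dense
  -- avalanche (right of L + d) start with fewer than d grains: they are fed
  -- before p fires, yet are still stable when p fires.
  between-peaks-low : ∀ {τ s ρ L q p i} → Start τ → Run τ s ρ → DenseFrom L s → NextPeak s q p →
    L + d ≤ q → q < i → i < p → τ i < d
  between-peaks-low {τ} {ρ = ρ} {L} {q} {i = i} τ-start r dense np L+d≤q q<i i<p
    with run-split prefix (subst (λ l → Run τ l ρ) shape-at-p r)
    where open NextPeak np
  ... | ρ₀ , r₀ , (_ , left-of-p-stable) ▸ _ =
    fed-below-D (τ i) (feeds i prefix) (feeds-pos w∈prefix (m∸n+n≡m d≤i))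
      (subst (_< D) (unfired-balance r₀ prefix<i) (left-of-p-stable i i<p))
    where
    open NextPeak np
    L+d≤i : L + d ≤ i
    L+d≤i = ≤-trans L+d≤q (<⇒≤ q<i)
    d≤i : d ≤ i
    d≤i = ≤-trans (m≤n+m d L) L+d≤i
    i≤q+d : i ≤ q + d
    i≤q+d = ≤-trans (<⇒≤ i<p) (proj₂ (next-peak-near τ-start r np))
    w∈prefix : i ∸ d ∈ prefix
    w∈prefix = fired-before-next-peak τ-start r np (dense-feeder dense q∈s L+d≤i i≤q+d)
                 (m≤n+o⇒m∸n≤o i d (subst (i ≤_) (+-comm q d) i≤q+d))
    prefix<i : All (_< i) prefix
    prefix<i = All.map (λ z≤q → ≤-<-trans z≤q q<i) prefix≤q

  L+2d≡L+d+d : ∀ L → L + 2 * d ≡ L + d + d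
  L+2d≡L+d+d L = regroup L e
    where
    regroup : ∀ L e → L + 2 * suc e ≡ L + suc e + suc e
    regroup = solve-∀

  L+d≤L+2d : ∀ L → L + d ≤ L + 2 * d
  L+d≤L+2d L = subst (L + d ≤_) (sym (L+2d≡L+d+d L)) (m≤m+n (L + d) d)

  positive-right-of-L+d : ∀ {L i} → L + d ≤ i → 1 ≤ i
  positive-right-of-L+d {L} L+d≤i = ≤-trans (s≤s z≤n) (≤-trans (m≤n+m d L) L+d≤i)

  positive-right-of-L+2d : ∀ {L i} → L + 2 * d ≤ i → 1 ≤ i
  positive-right-of-L+2d {L} L+2d≤i = positive-right-of-L+d (≤-trans (L+d≤L+2d L) L+2d≤i)

  -- Characterisation of peaks far enough right: in a dense avalanche, a column
  -- j with L + 2d ≤ j, not beyond some peak, is itself a peak as soon as it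
  -- starts with d grains (otherwise it would lie strictly between two peaks).
  full-column-peak : ∀ {τ s ρ L M j} → Start τ → Run τ s ρ → DenseFrom L s → IsPeak s M →
    L + 2 * d ≤ j → j ≤ M → τ j ≡ d → IsPeak s j
  full-column-peak {L = L} {j = j} τ-start r dense M-peak L+2d≤j j≤M τj≡d
    with straddling-peaks τ-start r M-peak (positive-right-of-L+2d L+2d≤j) j≤M
  ... | q , p , np , q<j , j≤p , _ with m≤n⇒m<n∨m≡n j≤p
  ...   | inj₂ refl = NextPeak.p-peak np
  ...   | inj₁ j<p = ⊥-elim (<-irrefl τj≡d (between-peaks-low τ-start r dense np L+d≤q q<j j<p))
    where
    L+d≤q : L + d ≤ q
    L+d≤q = +-cancelʳ-≤ d (L + d) q (begin
      L + d + d  ≡⟨ L+2d≡L+d+d L ⟨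
      L + 2 * d  ≤⟨ L+2d≤j ⟩
      j          ≤⟨ j≤p ⟩
      p          ≤⟨ proj₂ (next-peak-near τ-start r np) ⟩
      q + d      ∎)
      where open ≤-Reasoning

  -- At the end of a dense avalanche, a column j within d right of a fired
  -- column q ≥ L + d that started with d grains forces a firing right of q:
  -- otherwise j would still hold its d grains plus the one fed by j ∸ d.
  full-column-beyond : ∀ {τ s ρ L q j} → Start τ → Run τ s ρ → Stable D ρ → DenseFrom L s →
    q ∈ s → L + d ≤ q → q < j → j ≤ q + d → τ j ≡ d → ∃[ y ] y ∈ s × q < y
  full-column-beyond {τ} {s} {L = L} {q} {j} τ-start r ρ-stable dense q∈s L+d≤q q<j j≤q+d τj≡d
    with All.all? (_≤? q) s
  ... | no ¬s≤q = let y , y∈s , y≰q = find (¬All⇒Any¬ (_≤? q) s ¬s≤q) in y , y∈s , ≰⇒> y≰q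
  ... | yes s≤q = ⊥-elim (<-irrefl τj≡d
      (fed-below-D (τ j) (feeds j s) (feeds-pos feeder (m∸n+n≡m d≤j))
        (subst (_< D) (unfired-balance r (All.map (λ y≤q → ≤-<-trans y≤q q<j) s≤q)) (ρ-stable j))))
    where
    L+d≤j : L + d ≤ j
    L+d≤j = ≤-trans L+d≤q (<⇒≤ q<j)
    d≤j : d ≤ j
    d≤j = ≤-trans (m≤n+m d L) L+d≤j
    feeder : j ∸ d ∈ s
    feeder = dense-feeder dense q∈s L+d≤j j≤q+d

  -- A dense avalanche with maximal column M gives back, on every column j with
  -- L + d ≤ j < M, exactly what it took: j and j + 1 fire once and j is fed
  -- once, so the net change D·1 = d·1 + 1 vanishes.
  long-avalanche-restores : ∀ {τ s ρ L M j} → Start τ → Run τ s ρ → DenseFrom L s →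
    IsMaxOf s M → L + d ≤ j → j < M → ρ j ≡ τ j
  long-avalanche-restores {τ} {s} {ρ} {L} {M} {j} τ-start r dense M-max L+d≤j j<M =
    +-cancelʳ-≡ D (ρ j) (τ j) (begin
      ρ j + D                               ≡⟨ cong (ρ j +_) (*-identityʳ D) ⟨
      ρ j + D * 1                           ≡⟨ cong (λ n → ρ j + D * n) (fired-once j∈s) ⟨
      ρ j + D * fires j s                   ≡⟨ conservation r j ⟩
      τ j + d * fires (suc j) s + feeds j s ≡⟨ cong₂ (λ a b → τ j + d * a + b) (fired-once j+1∈s) fed-once ⟩
      τ j + d * 1 + 1                       ≡⟨ balance (τ j) e ⟩
      τ j + D                               ∎)
    where
    open ≡-Reasoning
    balance : ∀ a e → a + suc e * 1 + 1 ≡ a + suc (suc e)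
    balance = solve-∀
    once : ∀ i → fires i s ≤ 1
    once = proj₁ (settled τ-start r)
    fired-once : ∀ {i} → i ∈ s → fires i s ≡ 1
    fired-once {i} i∈s = ≤-antisym (once i) (fires-pos i∈s)
    L≤j : L ≤ j
    L≤j = ≤-trans (m≤m+n L d) L+d≤j
    j∈s : j ∈ s
    j∈s = dense M M-max j L≤j (<⇒≤ j<M)
    j+1∈s : suc j ∈ s
    j+1∈s = dense M M-max (suc j) (m≤n⇒m≤1+n L≤j) j<M
    fed-once : feeds j s ≡ 1
    fed-once = ≤-antisym (≤-trans (feeds≤fires j s) (once (j ∸ d)))
      (feeds-pos (dense-feeder dense (proj₁ M-max) L+d≤j (≤-trans (<⇒≤ j<M) (m≤m+n M d)))
        (m∸n+n≡m (≤-trans (m≤n+m d L) L+d≤j)))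

  short-avalanche-left : ∀ {L t} → ¬ (L + d ∈ t) → DenseFrom L t → All (_< L + d) t
  short-avalanche-left {L} {t} short dense = All.tabulate left
    where
    left : ∀ {x} → x ∈ t → x < L + d
    left {x} x∈t with L + d ≤? x
    ... | no x≱L+d = ≰⇒> x≱L+d
    ... | yes L+d≤x with maximum-peak x∈t
    ...   | top , top-max , _ =
      ⊥-elim (short (dense top top-max (L + d) (m≤m+n L d) (≤-trans L+d≤x (proj₂ top-max x x∈t))))

  short-avalanche-effect : ∀ {α t β L j} → LMRun D (addGrain α) t β → ¬ (L + d ∈ t) →
    DenseFrom L t → L + d ≤ j → α j ≤ β j × (L + 2 * d ≤ j → β j ≡ α j)
  short-avalanche-effect {α} {t} {β} {L} {j} avalanche short dense L+d≤j =
    subst (α j ≤_) (sym β≡α+fed) (m≤m+n (α j) (feeds j t)) , unchanged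
    where
    t-left : All (_< L + d) t
    t-left = short-avalanche-left short dense
    β≡α+fed : β j ≡ α j + feeds j t
    β≡α+fed = trans (unfired-balance (proj₁ (avalanche-run avalanche))
                       (All.map (λ x<L+d → <-≤-trans x<L+d L+d≤j) t-left))
                    (cong (_+ feeds j t) (addGrain-right α (positive-right-of-L+d L+d≤j)))
    unfed : L + 2 * d ≤ j → ∀ {x} → x < L + d → j ≢ x + d
    unfed L+2d≤j {x} x<L+d j≡x+d =
      <-irrefl (sym j≡x+d) (<-≤-trans (subst (x + d <_) (sym (L+2d≡L+d+d L)) (+-monoˡ-< d x<L+d)) L+2d≤j)
    unchanged : L + 2 * d ≤ j → β j ≡ α j
    unchanged L+2d≤j = begin
      β j              ≡⟨ β≡α+fed ⟩
      α j + feeds j t  ≡⟨ cong (α j +_) (feeds-absent (All.map (unfed L+2d≤j) t-left)) ⟩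
      α j + 0          ≡⟨ +-identityʳ (α j) ⟩
      α j              ∎
      where open ≡-Reasoning

  data Chain : Config → List (List ℕ) → Config → Set where
    []ᶜ  : ∀ {σ} → Chain σ [] σ
    _∷ᶜ_ : ∀ {σ s τ ss ρ} → LMRun D (addGrain σ) s τ → Chain τ ss ρ → Chain σ (s ∷ ss) ρ

  chain-snoc : ∀ {σ ss τ s ρ} → Chain σ ss τ → LMRun D (addGrain τ) s ρ → Chain σ (ss ∷ʳ s) ρ
  chain-snoc []ᶜ avalanche = avalanche ∷ᶜ []ᶜ
  chain-snoc (avalanche′ ∷ᶜ rest) avalanche = avalanche′ ∷ᶜ chain-snoc rest avalanche

  avalanches-chain : ∀ {k ss σ} → Avalanches D k ss σ → Chain zeroConfig ss σ
  avalanches-chain base = []ᶜ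
  avalanches-chain (next avs avalanche) = chain-snoc (avalanches-chain avs) avalanche

  chain-split : ∀ xs {ys σ ρ} → Chain σ (xs ++ ys) ρ → ∃[ τ ] Chain σ xs τ × Chain τ ys ρ
  chain-split [] c = _ , []ᶜ , c
  chain-split (x ∷ xs) (avalanche ∷ᶜ c) with chain-split xs c
  ... | τ , c₁ , c₂ = τ , avalanche ∷ᶜ c₁ , c₂

  chain-stable : ∀ {σ ss ρ} → Stable D σ → Chain σ ss ρ → Stable D ρ
  chain-stable σ-stable []ᶜ = σ-stable
  chain-stable _ (avalanche ∷ᶜ c) = chain-stable (proj₂ (avalanche-run avalanche)) c

  shorts-effect : ∀ {α B β L j} → Chain α B β → All (λ t → ¬ (L + d ∈ t)) B → All (DenseFrom L) B →
    L + d ≤ j → α j ≤ β j × (L + 2 * d ≤ j → β j ≡ α j)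
  shorts-effect []ᶜ _ _ _ = ≤-refl , λ _ → refl
  shorts-effect (avalanche ∷ᶜ c) (short ∷ shorts) (dense ∷ denses) L+d≤j
    with short-avalanche-effect avalanche short dense L+d≤j | shorts-effect c shorts denses L+d≤j
  ... | grows₁ , kept₁ | grows₂ , kept₂ = ≤-trans grows₁ grows₂ , λ far → trans (kept₂ far) (kept₁ far)

  filter-empty : ∀ {P : List ℕ → Set} (P? : ∀ t → Dec (P t)) xs → filter P? xs ≡ [] → All (¬_ ∘ P) xs
  filter-empty P? [] _ = []
  filter-empty P? (x ∷ xs) eq with P? x
  ... | no ¬px = ¬px ∷ filter-empty P? xs eq

  filter-cut : ∀ {P : List ℕ → Set} (P? : ∀ t → Dec (P t)) ss pre x rest →
    filter P? ss ≡ pre ++ x ∷ rest →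
    ∃[ A ] ∃[ C ] (ss ≡ A ++ x ∷ C) × P x × filter P? A ≡ pre × filter P? C ≡ rest
  filter-cut P? [] [] _ _ ()
  filter-cut P? [] (_ ∷ _) _ _ ()
  filter-cut P? (s ∷ ss) pre x rest eq with P? s
  filter-cut P? (s ∷ ss) [] x rest eq | yes ps with ∷-injective eq
  ... | refl , kept-rest = [] , ss , refl , ps , refl , kept-rest
  filter-cut P? (s ∷ ss) (p₀ ∷ pre) x rest eq | yes ps with ∷-injective eq
  ... | refl , eq′ with filter-cut P? ss pre x rest eq′
  ...   | A , C , refl , px , kept-A , kept-C =
    s ∷ A , C , refl , px , trans (filter-accept P? ps) (cong (s ∷_) kept-A) , kept-C
  filter-cut P? (s ∷ ss) pre x rest eq | no ¬ps with filter-cut P? ss pre x rest eq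
  ... | A , C , refl , px , kept-A , kept-C =
    s ∷ A , C , refl , px , trans (filter-reject P? ¬ps) kept-A , kept-C

  record ConsecutiveLong (L : ℕ) (φ φ′ : List ℕ) : Set where
    field
      π₀ σ α π₁    : Config
      π₀-stable    : Stable D π₀
      φ-avalanche  : LMRun D (addGrain π₀) φ σ
      shorts       : List (List ℕ)
      between      : Chain σ shorts α
      φ′-avalanche : LMRun D (addGrain α) φ′ π₁
      φ-long       : L + d ∈ φ
      φ′-long      : L + d ∈ φ′
      shorts-short : All (λ t → ¬ (L + d ∈ t)) shorts
      φ-dense      : DenseFrom L φ
      shorts-dense : All (DenseFrom L) shorts
      φ′-dense     : DenseFrom L φ′

  consecutive-long : ∀ {N ss σ L pre φ φ′ post} → Avalanches D N ss σ → All (DenseFrom L) ss →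
    longAvalanches D L ss ≡ pre ++ φ ∷ φ′ ∷ post → ConsecutiveLong L φ φ′
  consecutive-long {ss = ss} {L = L} {pre} {φ} {φ′} {post} avs dense long≡
    with filter-cut (λ t → L + d ∈? t) ss pre φ (φ′ ∷ post) long≡
  ... | A , C , refl , φ-long , _ , C-long
    with filter-cut (λ t → L + d ∈? t) C [] φ′ post C-long
  ... | B , E , refl , φ′-long , B-short , _
    with chain-split A (avalanches-chain avs)
  ... | π₀ , before , φ-avalanche ∷ᶜ rest
    with chain-split B rest
  ... | α , between , φ′-avalanche ∷ᶜ _ = record
    { π₀-stable = chain-stable (λ _ → s≤s z≤n) before
    ; φ-avalanche = φ-avalanche ; between = between ; φ′-avalanche = φ′-avalanche
    ; φ-long = φ-long ; φ′-long = φ′-long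
    ; shorts-short = filter-empty (λ t → L + d ∈? t) B B-short
    ; φ-dense = All.head from-φ
    ; shorts-dense = ++⁻ˡ B (All.tail from-φ)
    ; φ′-dense = All.head (++⁻ʳ B (All.tail from-φ))
    }
    where
    from-φ : All (DenseFrom L) (φ ∷ B ++ φ′ ∷ E)
    from-φ = ++⁻ʳ A dense

  module PeaksOfConsecutiveLong {L φ φ′} (c : ConsecutiveLong L φ φ′) where
    open ConsecutiveLong c

    τ τ′ : Config
    τ = addGrain π₀
    τ′ = addGrain α

    τ-start : Start τ
    τ-start = start-of-stable π₀-stable

    run : Run τ φ σ
    run = proj₁ (avalanche-run φ-avalanche)

    σ-stable : Stable D σ
    σ-stable = proj₂ (avalanche-run φ-avalanche)

    τ′-start : Start τ′
    τ′-start = start-of-stable (chain-stable σ-stable between)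

    run′ : Run τ′ φ′ π₁
    run′ = proj₁ (avalanche-run φ′-avalanche)

    π₁-stable : Stable D π₁
    π₁-stable = proj₂ (avalanche-run φ′-avalanche)

    M : ℕ
    M = proj₁ (maximum-peak φ-long)

    M-max : IsMaxOf φ M
    M-max = proj₁ (proj₂ (maximum-peak φ-long))

    M-peak : IsPeak φ M
    M-peak = proj₂ (proj₂ (maximum-peak φ-long))

    M′ : ℕ
    M′ = proj₁ (maximum-peak φ′-long)

    M′-max : IsMaxOf φ′ M′
    M′-max = proj₁ (proj₂ (maximum-peak φ′-long))

    M′-peak : IsPeak φ′ M′
    M′-peak = proj₂ (proj₂ (maximum-peak φ′-long))

    -- φ restores the columns in [L + d, M), and the short avalanches in
    -- between only add grains there (none from L + 2d on).
    grows : ∀ {i} → L + d ≤ i → i < M → τ i ≤ τ′ i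
    grows {i} L+d≤i i<M = begin
      τ i  ≡⟨ long-avalanche-restores τ-start run φ-dense M-max L+d≤i i<M ⟨
      σ i  ≤⟨ proj₁ (shorts-effect between shorts-short shorts-dense L+d≤i) ⟩
      α i  ≡⟨ addGrain-right α (positive-right-of-L+d L+d≤i) ⟨
      τ′ i ∎
      where open ≤-Reasoning

    kept : ∀ {i} → L + 2 * d ≤ i → i < M → τ′ i ≡ τ i
    kept {i} L+2d≤i i<M = begin
      τ′ i ≡⟨ addGrain-right α (positive-right-of-L+d L+d≤i) ⟩
      α i  ≡⟨ proj₂ (shorts-effect between shorts-short shorts-dense L+d≤i) L+2d≤i ⟩
      σ i  ≡⟨ long-avalanche-restores τ-start run φ-dense M-max L+d≤i i<M ⟩
      τ i  ∎
      where
      open ≡-Reasoning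
      L+d≤i : L + d ≤ i
      L+d≤i = ≤-trans (L+d≤L+2d L) L+2d≤i

    -- The peaks of φ left of M do not go beyond the maximal column M′ of φ′:
    -- otherwise the first peak c of φ beyond M′ would start full in τ′ within
    -- d of M′, and φ′ would have to fire right of M′.
    peaks-below-M′ : ∀ {j} → IsPeak φ j → j < M → j ≤ M′
    peaks-below-M′ {j} j-peak j<M with j ≤? M′
    ... | yes j≤M′ = j≤M′
    ... | no j≰M′ with straddling-peaks τ-start run j-peak (s≤s z≤n) (≰⇒> j≰M′)
    ...   | q , c , np , q≤M′ , M′<c , c≤j =
      let y , y∈φ′ , M′<y = full-column-beyond τ′-start run′ π₁-stable φ′-dense (proj₁ M′-max)
                              L+d≤M′ M′<c c≤M′+d τ′c≡d
      in ⊥-elim (<-irrefl refl (<-≤-trans M′<y (proj₂ M′-max y y∈φ′)))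
      where
      L+d≤M′ : L + d ≤ M′
      L+d≤M′ = proj₂ M′-max (L + d) φ′-long
      c≤M′+d : c ≤ M′ + d
      c≤M′+d = ≤-trans (proj₂ (next-peak-near τ-start run np)) (+-monoˡ-≤ d (≤-pred q≤M′))
      τ′c≡d : τ′ c ≡ d
      τ′c≡d = ≤-antisym (start-right {τ′} τ′-start (≤-trans (s≤s z≤n) M′<c))
        (subst (_≤ τ′ c) (proj₁ (next-peak-near τ-start run np))
          (grows (≤-trans L+d≤M′ (<⇒≤ M′<c)) (≤-<-trans c≤j j<M)))

    peaks-persist : ∀ {j} → IsPeak φ j → L + 2 * d ≤ j → j < M → IsPeak φ′ j
    peaks-persist {j} j-peak L+2d≤j j<M =
      full-column-peak τ′-start run′ φ′-dense M′-peak L+2d≤j (peaks-below-M′ j-peak j<M)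
        (trans (kept L+2d≤j j<M) (peak-full τ-start run j-peak (positive-right-of-L+2d L+2d≤j)))

    peaks-return : ∀ {j} → IsPeak φ′ j → L + 2 * d ≤ j → j < M → IsPeak φ j
    peaks-return {j} j-peak′ L+2d≤j j<M =
      full-column-peak τ-start run φ-dense M-peak L+2d≤j (<⇒≤ j<M)
        (trans (sym (kept L+2d≤j j<M)) (peak-full τ′-start run′ j-peak′ (positive-right-of-L+2d L+2d≤j)))

lemma1 : (D N : ℕ) → D ≥ 2 → N ≥ 1 →
    (ss : List (List ℕ)) (σ : Config) → Avalanches D N ss σ →
    (L : ℕ) → IsGlobalDensity ss L →
    (pre post : List (List ℕ)) (φk φk1 : List ℕ) →
    longAvalanches D L ss ≡ pre ++ φk ∷ φk1 ∷ post →
    (m : ℕ) → InP D L φk m → (∀ i → InP D L φk i → i ≤ m) →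
    ∀ j → ((InP D L φk j × ¬ (j ≡ m))
           ⇔ (InP D L φk1 j × (L + 2 * (D ∸ 1) ≤ j) × (j < m)))
lemma1 (suc (suc e)) _ (s≤s (s≤s z≤n)) _ _ _ avalanches L (dense , _) _ _ φ φ′ long≡
       m (m-peak , L+2d≤m) m-largest j = mk⇔ forward backward
  where
  open KSPM e
  open PeaksOfConsecutiveLong (consecutive-long avalanches dense long≡)

  m≤M : m ≤ M
  m≤M = proj₂ M-max m (peak-∈ m-peak)

  m≡M : m ≡ M
  m≡M = ≤-antisym m≤M (m-largest M (M-peak , ≤-trans L+2d≤m m≤M))

  forward : InP D L φ j × ¬ (j ≡ m) → InP D L φ′ j × (L + 2 * d ≤ j) × (j < m)
  forward ((j-peak , L+2d≤j) , j≢m) =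
    (peaks-persist j-peak L+2d≤j j<M , L+2d≤j) , L+2d≤j , subst (j <_) (sym m≡M) j<M
    where
    j<M : j < M
    j<M = ≤∧≢⇒< (proj₂ M-max j (peak-∈ j-peak)) (λ j≡M → j≢m (trans j≡M (sym m≡M)))

  backward : InP D L φ′ j × (L + 2 * d ≤ j) × (j < m) → InP D L φ j × ¬ (j ≡ m)
  backward ((j-peak′ , _) , L+2d≤j , j<m) =
    (peaks-return j-peak′ L+2d≤j (subst (j <_) m≡M j<m) , L+2d≤j) , λ j≡m → <-irrefl j≡m j<m
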